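{- Let $m,n,r$ be integers with $m,n\ge 1$ and $1\le r\le mn$, let $\mathcal{B}(m,n;r)$ be the set of boards described in the context, let $G$ be the symmetry group acting on $\mathcal{B}(m,n;r)$, and fix a division of the $m\times n$ grid into disjoint regions as in the context. Suppose a subset $\overline{\mathcal{B}}(m,n;r)\subseteq\mathcal{B}(m,n;r)$ satisfies: (1) $\overline{\mathcal{B}}(m,n;r)$ is a disjoint union of sets $\pi_1,\dots,\pi_t$, where each $\pi_i$ is the set of all boards in $\mathcal{B}(m,n;r)$ having some fixed board partition; (2) every board $B\in\mathcal{B}(m,n;r)$ is equivalent under $G$ to some $B'\in\overline{\mathcal{B}}(m,n;r)$; (3) if $B,B'\in\overline{\mathcal{B}}(m,n;r)$ are equivalent under $G$, then they have the same board partition (hence both lie in the same $\pi_i$). For each $1\le i\le t$ let $K_i\le G$ be the subgroup of all $g\in G$ with $g\cdot\pi_i=\pi_i$. Then \[|\mathcal{B}(m,n;r)|=\sum_{i=1}^t|\pi_i|\cdot[G:K_i].\]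
   Context: An $m\times n$ grid has cells $(i,j)$, $1\le i\le m$ (rows, top to bottom), $1\le j\le n$ (columns, left to right). A board in $\mathcal{B}(m,n;r)$ is a choice of exactly $r$ of the $mn$ cells, called blocked cells; so $|\mathcal{B}(m,n;r)|=\binom{mn}{r}$. The symmetry group $G$ acts on cells and hence on boards (by moving blocked cells): if $m=n>1$, $G=D_4$ (rotations by $0,90,180,270$ degrees about the center and reflections in the horizontal, vertical and two diagonal bisecting lines); if $m\ne n$ with $m,n>1$, $G=\{R_0,H,V,R_{180}\}$ (identity, reflection in the horizontal midline, reflection in the vertical midline, rotation by 180 degrees); if exactly one of $m,n$ equals $1$, $G=\{R_0,R_{180}\}$. Two boards are equivalent under $G$ if one is the image of the other under some $g\in G$. The grid is divided into finitely many disjoint regions (depending on $m,n$), in such a way that every element of $G$ maps each region onto a region; the board partition of a board is the ordered tuple giving the number of blocked cells in each region. -}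

module Defs where

open import Data.Nat using (ℕ; zero; suc; _≤_; _≡ᵇ_; _/_)
open import Data.Nat.Properties using () renaming (_≟_ to _≟ℕ_; _≤?_ to _≤?ℕ_)
open import Data.Bool using (Bool; true; false; _∧_; if_then_else_)
open import Data.Bool.Properties using () renaming (_≟_ to _≟B_)
open import Data.Fin using (Fin; opposite) renaming (_≟_ to _≟F_)
open import Data.List using (List; []; _∷_; map; concatMap; length; filter; sum; allFin; cartesianProduct)
open import Data.Vec using (Vec; []; _∷_; lookup; tabulate)
open import Data.Vec.Properties using (≡-dec)
open import Data.Product using (_×_; _,_; ∃; Σ)
open import Data.List.Membership.Propositional using (_∈_)
open import Relation.Nullary using (yes; no; does)
open import Relation.Binary.PropositionalEquality using (_≡_; refl)

Cell : ℕ → ℕ → Set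
Cell m n = Fin m × Fin n

data Sym : Set where
  r0 r90 r180 r270 h v d a : Sym

-- transposition (i , j) ↦ (j , i); only meaningful (and only used) when m ≡ n
tr : ∀ {m n} → Cell m n → Cell m n
tr {m} {n} (i , j) with m ≟ℕ n
... | yes refl = (j , i)
... | no _     = (i , j)

act : ∀ {m n} → Sym → Cell m n → Cell m n
act r0   c       = c
act r180 (i , j) = (opposite i , opposite j)
act h    (i , j) = (opposite i , j)
act v    (i , j) = (i , opposite j)
act d    c       = tr c
act a    c       = act r180 (tr c)
act r90  c       = act v (tr c)     -- (i , j) ↦ (j , opposite i)
act r270 c       = act h (tr c)     -- (i , j) ↦ (opposite j , i)

inv : Sym → Sym
inv r90  = r270
inv r270 = r90
inv g    = g

-- The symmetry group G of the m × n grid, as a list of its elements.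
-- m = n > 1 : D4;  m ≠ n, m,n > 1 : {R0,H,V,R180};  otherwise {R0,R180}
-- (this last case covers "exactly one of m,n is 1"; for the 1×1 grid
-- the group acts trivially in any case).
symGroup : ℕ → ℕ → List Sym
symGroup m n with m ≟ℕ n | 2 ≤?ℕ m | 2 ≤?ℕ n
... | yes _ | yes _ | _     = r0 ∷ r90 ∷ r180 ∷ r270 ∷ h ∷ v ∷ d ∷ a ∷ []
... | no _  | yes _ | yes _ = r0 ∷ h ∷ v ∷ r180 ∷ []
... | _     | _     | _     = r0 ∷ r180 ∷ []

-- Boards: an m × n array of Booleans (true = blocked cell)

Board : ℕ → ℕ → Set
Board m n = Vec (Vec Bool n) m

at : ∀ {m n} → Board m n → Cell m n → Bool
at B (i , j) = lookup (lookup B i) j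

_⋆_ : ∀ {m n} → Sym → Board m n → Board m n
g ⋆ B = tabulate λ i → tabulate λ j → at B (act (inv g) (i , j))

cells : (m n : ℕ) → List (Cell m n)
cells m n = cartesianProduct (allFin m) (allFin n)

count : ∀ {A : Set} → (A → Bool) → List A → ℕ
count P []       = 0
count P (x ∷ xs) = if P x then suc (count P xs) else count P xs

blocked : ∀ {m n} → Board m n → ℕ
blocked {m} {n} B = count (at B) (cells m n)

allVec : ∀ {A : Set} → List A → (n : ℕ) → List (Vec A n)
allVec xs zero    = [] ∷ []
allVec xs (suc n) = concatMap (λ x → map (x ∷_) (allVec xs n)) xs

allBoards : (m n : ℕ) → List (Board m n)
allBoards m n = allVec (allVec (true ∷ false ∷ []) n) m

numBoards : (m n r : ℕ) → ℕ
numBoards m n r = count (λ B → blocked B ≡ᵇ r) (allBoards m n)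

-- A division into k regions is a map ρ assigning each cell its region.
-- Every g ∈ G maps each region onto a region.
RegionsCompatible : (m n k : ℕ) → (Cell m n → Fin k) → Set
RegionsCompatible m n k ρ =
  ∀ g → g ∈ symGroup m n → ∀ (x : Fin k) → ∃ λ (y : Fin k) → ∀ (c : Cell m n) →
    (ρ c ≡ x → ρ (act g c) ≡ y) × (ρ (act g c) ≡ y → ρ c ≡ x)

partition : ∀ {m n k} → (Cell m n → Fin k) → Board m n → Vec ℕ k
partition {m} {n} ρ B =
  tabulate λ x → count (λ c → at B c ∧ does (ρ c ≟F x)) (cells m n)

inClass : ∀ {m n k} → (Cell m n → Fin k) → ℕ → Vec ℕ k → Board m n → Bool
inClass ρ r p B = (blocked B ≡ᵇ r) ∧ does (≡-dec _≟ℕ_ (partition ρ B) p)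

classSize : (m n r k : ℕ) → (Cell m n → Fin k) → Vec ℕ k → ℕ
classSize m n r k ρ p = count (inClass ρ r p) (allBoards m n)

-- does g · π = π hold (g acting bijectively on boards)?
stabilises : (m n r k : ℕ) → (Cell m n → Fin k) → Vec ℕ k → Sym → Bool
stabilises m n r k ρ p g =
  all' (allBoards m n)
  where
    all' : List (Board m n) → Bool
    all' []       = true
    all' (B ∷ Bs) = does (inClass ρ r p B ≟B inClass ρ r p (g ⋆ B)) ∧ all' Bs

-- natural-number division (the divisor below is never 0, since the
-- identity always stabilises)
_div_ : ℕ → ℕ → ℕ
x div zero    = 0
x div (suc y) = x / suc y

stabIndex : (m n r k : ℕ) → (Cell m n → Fin k) → Vec ℕ k → ℕ
stabIndex m n r k ρ p =
  length (symGroup m n) div length (filter (λ g → stabilises m n r k ρ p g ≟B true) (symGroup m n))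

Equivalent : ∀ {m n} → Board m n → Board m n → Set
Equivalent {m} {n} B B' = ∃ λ g → g ∈ symGroup m n × g ⋆ B ≡ B'

{-# OPTIONS --safe #-}
-- Every class πᵢ (boards with r blocked cells and board partition pᵢ) is a block of
-- the action of G on boards: a symmetry permutes the regions, so it carries the boards
-- of one board partition onto the boards of a single other board partition. For a block
-- π with stabiliser K, counting the pairs (g , B) with g · B ∈ π in two ways gives
-- |K| · |G · π| = |G| · |π|, and Lagrange's theorem turns this into
-- |G · π| = |π| · [G : K]. Hypotheses (1)–(3) say that the saturations G · πᵢ
-- partition B(m,n;r).
module Submission where

open import Defs
open import Algebra.Bundles using (Group)
open import Algebra.Core using (Op₁; Op₂)
open import Algebra.Properties.CommutativeSemigroup using (interchange)
open import Algebra.Structures using (IsGroup)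
open import Data.Bool using (Bool; true; false; T; not; _∧_; _xor_; if_then_else_)
open import Data.Bool.ListAction using (all; any)
open import Data.Bool.Properties using (T-∧) renaming (_≟_ to _≟ᵇ_)
open import Data.Empty using (⊥-elim)
open import Data.Fin using (Fin; opposite) renaming (_≟_ to _≟ᶠ_)
open import Data.Fin.Properties using (opposite-involutive)
open import Data.List
  using (List; []; _∷_; map; length; filter; foldr; _++_; concatMap; cartesianProductWith; allFin)
open import Data.List.Membership.Propositional using (_∈_; find; lose)
open import Data.List.Membership.Propositional.Properties
  using (∈-map⁺; ∈-map⁻; ∈-allFin; ∈-cartesianProduct⁺; ∈-cartesianProductWith⁺)
open import Data.List.Membership.Propositional.Properties.WithK using (unique∧set⇒bag)
open import Data.List.Properties using (map-cong; map-cong-local; foldr-universal)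
open import Data.List.Relation.Binary.BagAndSetEquality using (∼bag⇒↭)
open import Data.List.Relation.Binary.Permutation.Propositional using (_↭_)
open import Data.List.Relation.Binary.Permutation.Propositional.Properties using (↭-length; filter-↭)
open import Data.List.Relation.Unary.All as All using (All; []; _∷_; all?)
open import Data.List.Relation.Unary.All.Properties using (all⁺; all⁻)
open import Data.List.Relation.Unary.AllPairs using ([]; _∷_)
open import Data.List.Relation.Unary.Any using (here; there)
open import Data.List.Relation.Unary.Any.Properties using (any⁺; any⁻)
open import Data.List.Relation.Unary.Unique.Propositional using (Unique)
import Data.List.Relation.Unary.Unique.Propositional.Properties as Unique
open import Data.Nat using (ℕ; zero; suc; _+_; _*_; _<_; _≤_; _≡ᵇ_; s≤s; z≤n)
open import Data.Nat.Divisibility using (_∣_; divides; _∣0; ∣-reflexive; ∣m∣n⇒∣m+n)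
open import Data.Nat.DivMod using (_/_; m*n/n≡m)
open import Data.Nat.ListAction using (sum)
open import Data.Nat.Properties
  using ( +-suc; *-comm; *-assoc; *-zeroʳ; *-identityʳ; *-cancelˡ-≡; +-commutativeSemigroup
        ; ≡ᵇ⇒≡; ≡⇒≡ᵇ)
  renaming (_≟_ to _≟ℕ_; _≤?_ to _≤?ℕ_)
open import Data.Product using (_×_; _,_; proj₁; proj₂; ∃; swap)
open import Data.Product.Properties using () renaming (≡-dec to ×-≡-dec)
open import Data.Sum using (_⊎_; inj₁; inj₂)
open import Data.Vec using (Vec; []; _∷_; lookup; tabulate)
open import Data.Vec.Properties using (lookup∘tabulate; tabulate∘lookup; tabulate-cong; ∷-injective; ≡-dec)
open import Function using (_∘_; id; _⇔_; mk⇔; Equivalence)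
open import Level using (0ℓ)
open import Relation.Binary.Definitions using (DecidableEquality)
open import Relation.Binary.PropositionalEquality
  using (_≡_; refl; sym; trans; cong; cong₂; subst; module ≡-Reasoning)
open import Relation.Binary.PropositionalEquality.Algebra using (isMagma)
open import Relation.Nullary using (Dec; yes; no; does; ¬_; _×-dec_)
open import Relation.Nullary.Decidable using (map′; from-yes; dec-true; does-⇔; T?)
open import Relation.Unary using (Decidable)

open ≡-Reasoning

private
  variable
    A B C : Set

bool-ext : ∀ {p q : Bool} → (T p → T q) → (T q → T p) → p ≡ q
bool-ext {p} {q} to from = does-⇔ (mk⇔ to from) (T? p) (T? q)

T-∧-not : ∀ {p q} → T (p ∧ not q) ⇔ (T p × ¬ T q)
T-∧-not {true}  {true}  = mk⇔ (λ ()) (λ { (_ , ¬q) → ¬q _ })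
T-∧-not {true}  {false} = mk⇔ (λ _ → _ , λ ()) (λ _ → _)
T-∧-not {false}         = mk⇔ (λ ()) (λ { (() , _) })

∧-absorbʳ : ∀ {p q} → (T q → T p) → p ∧ q ≡ q
∧-absorbʳ {true}          _   = refl
∧-absorbʳ {false} {false} _   = refl
∧-absorbʳ {false} {true}  q⇒p = ⊥-elim (q⇒p _)

does-sound : ∀ {P : Set} (p : Dec P) → T (does p) → P
does-sound (yes p) _ = p

does-complete : ∀ {P : Set} (p : Dec P) → P → T (does p)
does-complete p x = subst T (sym (dec-true p x)) _

drop-head : ∀ {S : A → Bool} {x y zs} → ¬ T (S x) → T (S y) → y ∈ x ∷ zs → y ∈ zs
drop-head ¬Sx Sy (here refl) = ⊥-elim (¬Sx Sy)
drop-head _   _  (there y∈)  = y∈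

cancel-by-quotient : ∀ k {n c c′} → suc k ∣ n → suc k * c ≡ n * c′ → c ≡ c′ * (n div suc k)
cancel-by-quotient k {c = c} {c′} (divides q refl) balance = begin
  c                        ≡⟨ *-cancelˡ-≡ c (q * c′) (suc k) (begin
                                suc k * c        ≡⟨ balance ⟩
                                q * suc k * c′   ≡⟨ cong (_* c′) (*-comm q (suc k)) ⟩
                                suc k * q * c′   ≡⟨ *-assoc (suc k) q c′ ⟩
                                suc k * (q * c′) ∎) ⟩
  q * c′                   ≡⟨ *-comm q c′ ⟩
  c′ * q                   ≡⟨ cong (c′ *_) (m*n/n≡m q (suc k)) ⟨
  c′ * (q * suc k / suc k) ∎

count-∷ : ∀ (f : A → Bool) x xs → count f (x ∷ xs) ≡ (if f x then 1 else 0) + count f xs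
count-∷ f x xs with f x
... | true  = refl
... | false = refl

count-cong : ∀ {f g : A → Bool} {xs} → (∀ {x} → x ∈ xs → f x ≡ g x) → count f xs ≡ count g xs
count-cong {xs = []}     f≡g = refl
count-cong {f = f} {g} {x ∷ xs} f≡g = begin
  count f (x ∷ xs)                     ≡⟨ count-∷ f x xs ⟩
  (if f x then 1 else 0) + count f xs  ≡⟨ cong₂ (λ b c → (if b then 1 else 0) + c)
                                                (f≡g (here refl)) (count-cong (f≡g ∘ there)) ⟩
  (if g x then 1 else 0) + count g xs  ≡⟨ count-∷ g x xs ⟨
  count g (x ∷ xs)                     ∎

count-zero : ∀ {f : A → Bool} {xs} → (∀ {x} → x ∈ xs → ¬ T (f x)) → count f xs ≡ 0
count-zero {xs = []}       _    = refl
count-zero {f = f} {x ∷ xs} none with f x in fx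
... | true  = ⊥-elim (none (here refl) (subst T (sym fx) _))
... | false = count-zero (none ∘ there)

count-pos : ∀ {f : A → Bool} {x xs} → x ∈ xs → T (f x) → 0 < count f xs
count-pos {f = f} {xs = y ∷ xs} x∈ fx with f y in fy
... | true = s≤s z≤n
count-pos {f = f} {xs = y ∷ xs} (here refl) fx | false = ⊥-elim (subst T fy fx)
count-pos {f = f} {xs = y ∷ xs} (there x∈)  fx | false = count-pos x∈ fx

count-true : ∀ xs → count (λ (_ : A) → true) xs ≡ length xs
count-true []       = refl
count-true (x ∷ xs) = cong suc (count-true xs)

count-filter : ∀ (f : A → Bool) xs → count f xs ≡ length (filter (λ x → f x ≟ᵇ true) xs)
count-filter f []       = refl
count-filter f (x ∷ xs) with f x
... | true  = cong suc (count-filter f xs)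
... | false = count-filter f xs

count-split : ∀ (f g : A → Bool) xs →
  count f xs ≡ count (λ x → f x ∧ g x) xs + count (λ x → f x ∧ not (g x)) xs
count-split f g []       = refl
count-split f g (x ∷ xs) with f x | g x
... | true  | true  = cong suc (count-split f g xs)
... | true  | false = trans (cong suc (count-split f g xs)) (sym (+-suc _ _))
... | false | _     = count-split f g xs

count-≟ : ∀ (_≟_ : DecidableEquality A) {x xs} → Unique xs → x ∈ xs →
  count (λ y → does (y ≟ x)) xs ≡ 1
count-≟ _≟_ {x} {y ∷ xs} (y∉xs ∷ xs!) x∈ with y ≟ x | x∈
... | yes refl | _          =
  cong suc (count-zero λ {z} z∈ z≡y → All.lookup y∉xs z∈ (sym (does-sound (z ≟ y) z≡y)))
... | no y≢x   | here x≡y   = ⊥-elim (y≢x (sym x≡y))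
... | no _     | there x∈xs = count-≟ _≟_ xs! x∈xs

count-map : ∀ (f : B → Bool) (φ : A → B) xs → count f (map φ xs) ≡ count (f ∘ φ) xs
count-map f φ []       = refl
count-map f φ (x ∷ xs) with f (φ x)
... | true  = cong suc (count-map f φ xs)
... | false = count-map f φ xs

count-↭ : ∀ (f : A → Bool) {xs ys} → xs ↭ ys → count f xs ≡ count f ys
count-↭ f {xs} {ys} xs↭ys = begin
  count f xs                              ≡⟨ count-filter f xs ⟩
  length (filter (λ x → f x ≟ᵇ true) xs)  ≡⟨ ↭-length (filter-↭ (λ x → f x ≟ᵇ true) xs↭ys) ⟩
  length (filter (λ x → f x ≟ᵇ true) ys)  ≡⟨ count-filter f ys ⟨
  count f ys                              ∎

count-∘-bijection : ∀ (f : A → Bool) {xs} (φ ψ : A → A) → Unique xs →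
  (∀ x → ψ (φ x) ≡ x) → (∀ x → φ (ψ x) ≡ x) →
  (∀ {x} → x ∈ xs → φ x ∈ xs) → (∀ {x} → x ∈ xs → ψ x ∈ xs) →
  count (f ∘ φ) xs ≡ count f xs
count-∘-bijection f {xs} φ ψ xs! ψφ φψ φ∈ ψ∈ =
  trans (sym (count-map f φ xs)) (count-↭ f (∼bag⇒↭ (unique∧set⇒bag φxs! xs! (mk⇔ to from))))
  where
  φxs! : Unique (map φ xs)
  φxs! = Unique.map⁺ (λ {x} {y} φx≡φy → trans (sym (ψφ x)) (trans (cong ψ φx≡φy) (ψφ y))) xs!
  to : ∀ {y} → y ∈ map φ xs → y ∈ xs
  to y∈ with ∈-map⁻ φ y∈
  ... | x , x∈ , refl = φ∈ x∈
  from : ∀ {y} → y ∈ xs → y ∈ map φ xs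
  from {y} y∈ = subst (_∈ map φ xs) (φψ y) (∈-map⁺ φ (ψ∈ y∈))

sum-map-+ : ∀ (f g : A → ℕ) xs → sum (map (λ x → f x + g x) xs) ≡ sum (map f xs) + sum (map g xs)
sum-map-+ f g []       = refl
sum-map-+ f g (x ∷ xs) = trans (cong (f x + g x +_) (sum-map-+ f g xs))
                               (interchange +-commutativeSemigroup (f x) (g x) _ _)

sum-const : ∀ c (xs : List A) → sum (map (λ _ → c) xs) ≡ length xs * c
sum-const c []       = refl
sum-const c (x ∷ xs) = cong (c +_) (sum-const c xs)

sum-if : ∀ (f : A → Bool) c xs → sum (map (λ x → if f x then c else 0) xs) ≡ count f xs * c
sum-if f c []       = refl
sum-if f c (x ∷ xs) with f x
... | true  = cong (c +_) (sum-if f c xs)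
... | false = sum-if f c xs

count-as-sum : ∀ (f : A → Bool) xs → count f xs ≡ sum (map (λ x → if f x then 1 else 0) xs)
count-as-sum f xs = sym (trans (sum-if f 1 xs) (*-identityʳ _))

count-swap : ∀ (R : A → B → Bool) xs ys →
  sum (map (λ x → count (R x) ys) xs) ≡ sum (map (λ y → count (λ x → R x y) xs) ys)
count-swap R []       ys = sym (trans (sum-const 0 ys) (*-zeroʳ (length ys)))
count-swap R (x ∷ xs) ys = begin
  count (R x) ys + sum (map (λ x → count (R x) ys) xs)
    ≡⟨ cong₂ _+_ (count-as-sum (R x) ys) (count-swap R xs ys) ⟩
  sum (map (λ y → if R x y then 1 else 0) ys) + sum (map (λ y → count (λ x → R x y) xs) ys)
    ≡⟨ sum-map-+ (λ y → if R x y then 1 else 0) (λ y → count (λ x → R x y) xs) ys ⟨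
  sum (map (λ y → (if R x y then 1 else 0) + count (λ x → R x y) xs) ys)
    ≡⟨ cong sum (map-cong (λ y → count-∷ (λ x → R x y) x xs) ys) ⟨
  sum (map (λ y → count (λ x → R x y) (x ∷ xs)) ys) ∎

count-partition : ∀ (f : A → Bool) (g : B → A → Bool) xs is →
  (∀ x → count (λ i → g i x) is ≡ (if f x then 1 else 0)) →
  count f xs ≡ sum (map (λ i → count (g i) xs) is)
count-partition f g xs is exactly-one = begin
  count f xs                                   ≡⟨ count-as-sum f xs ⟩
  sum (map (λ x → if f x then 1 else 0) xs)    ≡⟨ cong sum (map-cong (sym ∘ exactly-one) xs) ⟩
  sum (map (λ x → count (λ i → g i x) is) xs)  ≡⟨ count-swap (λ x i → g i x) xs is ⟩
  sum (map (λ i → count (g i) xs) is)          ∎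

module GroupTheory {A : Set} {_∙_ : Op₂ A} {ε : A} {_⁻¹ : Op₁ A}
                   (isGroup : IsGroup _≡_ _∙_ ε _⁻¹) where

  open IsGroup isGroup using (assoc; inverseˡ; inverseʳ; _\\_; _//_)

  private
    group : Group 0ℓ 0ℓ
    group = record { isGroup = isGroup }

  open import Algebra.Properties.Group group
    using (\\-leftDividesˡ; \\-leftDividesʳ; //-rightDividesˡ; //-rightDividesʳ)

  record FiniteSubgroup (G : List A) : Set where
    field
      unique : Unique G
      ε∈     : ε ∈ G
      ∙∈     : ∀ {g g′} → g ∈ G → g′ ∈ G → (g ∙ g′) ∈ G
      ⁻¹∈    : ∀ {g} → g ∈ G → (g ⁻¹) ∈ G

  module _ {G : List A} (subgroup : FiniteSubgroup G) where

    open FiniteSubgroup subgroup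

    count-translateˡ : ∀ (f : A → Bool) {g} → g ∈ G → count (λ x → f (g ∙ x)) G ≡ count f G
    count-translateˡ f {g} g∈ = count-∘-bijection f (g ∙_) (g \\_) unique
      (\\-leftDividesʳ g) (\\-leftDividesˡ g) (∙∈ g∈) (∙∈ (⁻¹∈ g∈))

    count-translateʳ : ∀ (f : A → Bool) {g} → g ∈ G → count (λ x → f (x ∙ g)) G ≡ count f G
    count-translateʳ f {g} g∈ = count-∘-bijection f (_∙ g) (_// g) unique
      (//-rightDividesʳ g) (//-rightDividesˡ g) (λ x∈ → ∙∈ x∈ g∈) (λ x∈ → ∙∈ x∈ (⁻¹∈ g∈))

    record IsSubgroup (K : A → Bool) : Set where
      field
        ε-mem  : T (K ε)
        ∙-mem  : ∀ {g g′} → g ∈ G → g′ ∈ G → T (K g) → T (K g′) → T (K (g ∙ g′))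
        ⁻¹-mem : ∀ {g} → g ∈ G → T (K g) → T (K (g ⁻¹))

    module _ {K : A → Bool} (K-subgroup : IsSubgroup K) where

      open IsSubgroup K-subgroup

      coset : A → A → Bool
      coset x y = K (x \\ y)

      UnionOfCosets : (A → Bool) → Set
      UnionOfCosets S = ∀ {y k} → y ∈ G → k ∈ G → T (S y) → T (K k) → T (S (y ∙ k))

      coset-self : ∀ x → T (coset x x)
      coset-self x = subst (T ∘ K) (sym (inverseˡ x)) ε-mem

      coset-⊆ : ∀ {S x y} → UnionOfCosets S → x ∈ G → T (S x) → y ∈ G → T (coset x y) → T (S y)
      coset-⊆ {S} {x} {y} S-union x∈ Sx y∈ xKy =
        subst (T ∘ S) (\\-leftDividesˡ x y) (S-union x∈ (∙∈ (⁻¹∈ x∈) y∈) Sx xKy)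

      remove-coset : ∀ {S x} → UnionOfCosets S → x ∈ G → UnionOfCosets (λ y → S y ∧ not (coset x y))
      remove-coset {x = x} S-union x∈ {y} {k} y∈ k∈ S∖xKy Kk =
        let Sy , ¬xKy = Equivalence.to T-∧-not S∖xKy in
        Equivalence.from T-∧-not (S-union y∈ k∈ Sy Kk , λ xKyk → ¬xKy (subst (T ∘ K) cancel-k
          (∙-mem (∙∈ (⁻¹∈ x∈) (∙∈ y∈ k∈)) (⁻¹∈ k∈) xKyk (⁻¹-mem k∈ Kk))))
        where
        cancel-k : (x \\ (y ∙ k)) ∙ (k ⁻¹) ≡ x \\ y
        cancel-k = trans (assoc (x ⁻¹) (y ∙ k) (k ⁻¹)) (cong ((x ⁻¹) ∙_) (//-rightDividesʳ k y))

      -- Induction on a list zs covering S: if its head x lies in S, then the coset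
      -- xK ⊆ S contributes count K G and is removed from S.
      count-union-of-cosets : ∀ zs → All (_∈ G) zs → ∀ {S} → UnionOfCosets S →
        (∀ {y} → y ∈ G → T (S y) → y ∈ zs) → count K G ∣ count S G
      count-union-of-cosets [] _ _ S⊆[] =
        subst (count K G ∣_) (sym (count-zero λ y∈ Sy → ∉[] (S⊆[] y∈ Sy))) (count K G ∣0)
        where ∉[] : ∀ {y : A} → ¬ y ∈ []
              ∉[] ()
      count-union-of-cosets (x ∷ zs) (x∈ ∷ zs⊆G) {S} S-union S⊆ with S x in Sx
      ... | false = count-union-of-cosets zs zs⊆G S-union λ y∈ Sy →
                      drop-head (λ Sx′ → subst T Sx Sx′) Sy (S⊆ y∈ Sy)
      ... | true  = subst (count K G ∣_) (sym (count-split S (coset x) G)) (∣m∣n⇒∣m+n xK⊆S S∖xK)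
        where
        xK⊆S : count K G ∣ count (λ y → S y ∧ coset x y) G
        xK⊆S = ∣-reflexive (sym (trans
          (count-cong λ y∈ → ∧-absorbʳ (coset-⊆ S-union x∈ (subst T (sym Sx) _) y∈))
          (count-translateˡ K (⁻¹∈ x∈))))

        S∖xK : count K G ∣ count (λ y → S y ∧ not (coset x y)) G
        S∖xK = count-union-of-cosets zs zs⊆G (remove-coset S-union x∈) λ y∈ S∖xKy →
          drop-head {S = λ y → S y ∧ not (coset x y)}
                    (λ S∖xKx → proj₂ (Equivalence.to T-∧-not S∖xKx) (coset-self x))
                    S∖xKy (S⊆ y∈ (proj₁ (Equivalence.to T-∧-not S∖xKy)))

      lagrange : count K G ∣ length G
      lagrange = subst (count K G ∣_) (count-true G)
        (count-union-of-cosets G (All.tabulate id) (λ _ _ _ _ → _) (λ y∈ _ → y∈))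

    module Action {X : Set} (_⋆_ : A → X → X) (⋆-identity : ∀ x → ε ⋆ x ≡ x)
                  (⋆-∙ : ∀ {g g′} → g ∈ G → g′ ∈ G → ∀ x → g ⋆ (g′ ⋆ x) ≡ (g ∙ g′) ⋆ x)
                  {Xs : List X} (Xs-unique : Unique Xs) (Xs-complete : ∀ x → x ∈ Xs) where

      ⋆-inverseˡ : ∀ {g} → g ∈ G → ∀ x → (g ⁻¹) ⋆ (g ⋆ x) ≡ x
      ⋆-inverseˡ {g} g∈ x =
        trans (⋆-∙ (⁻¹∈ g∈) g∈ x) (trans (cong (_⋆ x) (inverseˡ g)) (⋆-identity x))

      ⋆-inverseʳ : ∀ {g} → g ∈ G → ∀ x → g ⋆ ((g ⁻¹) ⋆ x) ≡ x
      ⋆-inverseʳ {g} g∈ x =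
        trans (⋆-∙ g∈ (⁻¹∈ g∈) x) (trans (cong (_⋆ x) (inverseʳ g)) (⋆-identity x))

      ⋆-// : ∀ {g g′} → g ∈ G → g′ ∈ G → ∀ x → (g // g′) ⋆ (g′ ⋆ x) ≡ g ⋆ x
      ⋆-// {g} {g′} g∈ g′∈ x =
        trans (⋆-∙ (∙∈ g∈ (⁻¹∈ g′∈)) g′∈ x) (cong (_⋆ x) (//-rightDividesˡ g′ g))

      count-⋆ : ∀ (f : X → Bool) {g} → g ∈ G → count (λ x → f (g ⋆ x)) Xs ≡ count f Xs
      count-⋆ f {g} g∈ = count-∘-bijection f (g ⋆_) ((g ⁻¹) ⋆_) Xs-unique
        (⋆-inverseˡ g∈) (⋆-inverseʳ g∈) (λ _ → Xs-complete _) (λ _ → Xs-complete _)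

      IsBlock : (X → Bool) → Set
      IsBlock π = ∀ g x y → g ∈ G → T (π x) → T (π y) → π (g ⋆ x) ≡ π (g ⋆ y)

      stabiliser : (X → Bool) → A → Bool
      stabiliser π g = all (λ x → does (π x ≟ᵇ π (g ⋆ x))) Xs

      saturation : (X → Bool) → X → Bool
      saturation π x = any (λ g → π (g ⋆ x)) G

      module _ {π : X → Bool} where

        stabiliser-sound : ∀ {g} → T (stabiliser π g) → ∀ x → π x ≡ π (g ⋆ x)
        stabiliser-sound st x = does-sound (π x ≟ᵇ _) (All.lookup (all⁺ _ Xs st) (Xs-complete x))

        stabiliser-complete : ∀ {g} → (∀ x → π x ≡ π (g ⋆ x)) → T (stabiliser π g)
        stabiliser-complete {g} eq = all⁻ (λ x → does (π x ≟ᵇ π (g ⋆ x))) {Xs}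
          (All.tabulate λ {x} _ → does-complete (π x ≟ᵇ _) (eq x))

        stabiliser-isSubgroup : IsSubgroup (stabiliser π)
        stabiliser-isSubgroup = record
          { ε-mem  = stabiliser-complete λ x → cong π (sym (⋆-identity x))
          ; ∙-mem  = λ {g} {g′} g∈ g′∈ sg sg′ → stabiliser-complete λ x →
              trans (stabiliser-sound sg′ x)
                    (trans (stabiliser-sound sg (g′ ⋆ x)) (cong π (⋆-∙ g∈ g′∈ x)))
          ; ⁻¹-mem = λ {g} g∈ sg → stabiliser-complete λ x →
              trans (cong π (sym (⋆-inverseʳ g∈ x))) (sym (stabiliser-sound sg ((g ⁻¹) ⋆ x)))
          }

        block-translate : IsBlock π → ∀ {g x} → g ∈ G → T (π x) → π (g ⋆ x) ≡ stabiliser π g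
        block-translate block {g} {x} g∈ πx = bool-ext to (λ st → subst T (stabiliser-sound st x) πx)
          where
          to : T (π (g ⋆ x)) → T (stabiliser π g)
          to πgx = stabiliser-complete λ y → bool-ext
            (λ πy → subst T (block g x y g∈ πx πy) πgx)
            (λ πgy → subst T (begin
                π x                   ≡⟨ cong π (⋆-inverseˡ g∈ x) ⟨
                π ((g ⁻¹) ⋆ (g ⋆ x))  ≡⟨ block (g ⁻¹) (g ⋆ x) (g ⋆ y) (⁻¹∈ g∈) πgx πgy ⟩
                π ((g ⁻¹) ⋆ (g ⋆ y))  ≡⟨ cong π (⋆-inverseˡ g∈ y) ⟩
                π y                   ∎) πx)

        count-translates : IsBlock π → ∀ x →
          count (λ g → π (g ⋆ x)) G ≡ (if saturation π x then count (stabiliser π) G else 0)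
        count-translates block x with saturation π x in sat
        ... | false = count-zero {xs = G} λ g∈ πgx →
                        subst T sat (any⁺ (λ g → π (g ⋆ x)) (lose g∈ πgx))
        ... | true with find (any⁻ (λ g → π (g ⋆ x)) G (subst T (sym sat) _))
        ...   | g₀ , g₀∈ , πg₀x =
          trans (count-cong translate) (count-translateʳ (stabiliser π) (⁻¹∈ g₀∈))
          where
          translate : ∀ {g} → g ∈ G → π (g ⋆ x) ≡ stabiliser π (g // g₀)
          translate g∈ = trans (cong π (sym (⋆-// g∈ g₀∈ x)))
                               (block-translate block (∙∈ g∈ (⁻¹∈ g₀∈)) πg₀x)

        orbit-count : IsBlock π → count (stabiliser π) G * count (saturation π) Xs ≡ length G * count π Xs
        orbit-count block = begin
          count (stabiliser π) G * count (saturation π) Xs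
            ≡⟨ *-comm _ (count (saturation π) Xs) ⟩
          count (saturation π) Xs * count (stabiliser π) G
            ≡⟨ sum-if (saturation π) _ Xs ⟨
          sum (map (λ x → if saturation π x then count (stabiliser π) G else 0) Xs)
            ≡⟨ cong sum (map-cong (count-translates block) Xs) ⟨
          sum (map (λ x → count (λ g → π (g ⋆ x)) G) Xs)
            ≡⟨ count-swap (λ x g → π (g ⋆ x)) Xs G ⟩
          sum (map (λ g → count (λ x → π (g ⋆ x)) Xs) G)
            ≡⟨ cong sum (map-cong-local (All.tabulate λ g∈ → count-⋆ π g∈)) ⟩
          sum (map (λ _ → count π Xs) G)
            ≡⟨ sum-const _ G ⟩
          length G * count π Xs ∎

        count-saturation : IsBlock π →
          count (saturation π) Xs ≡ count π Xs * (length G div count (stabiliser π) G)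
        count-saturation block with count (stabiliser π) G
                                  | lagrange stabiliser-isSubgroup
                                  | orbit-count block
                                  | count-pos {f = stabiliser π} ε∈ (IsSubgroup.ε-mem stabiliser-isSubgroup)
        ... | suc k | K∣G | balance | _ = cancel-by-quotient k K∣G balance

-- A symmetry is encoded by (transpose?, reverse rows?, reverse columns?); it
-- transposes first and then reverses, see act-⟦⟧.
code : Sym → Bool × Bool × Bool
code r0   = false , false , false
code r90  = true  , false , true
code r180 = false , true  , true
code r270 = true  , true  , false
code h    = false , true  , false
code v    = false , false , true
code d    = true  , false , false
code a    = true  , true  , true

decode : Bool × Bool × Bool → Sym
decode (false , false , false) = r0
decode (true  , false , true ) = r90
decode (false , true  , true ) = r180
decode (true  , true  , false) = r270
decode (false , true  , false) = h
decode (false , false , true ) = v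
decode (true  , false , false) = d
decode (true  , true  , true ) = a

decode-code : ∀ g → decode (code g) ≡ g
decode-code r0   = refl
decode-code r90  = refl
decode-code r180 = refl
decode-code r270 = refl
decode-code h    = refl
decode-code v    = refl
decode-code d    = refl
decode-code a    = refl

code-decode : ∀ b → code (decode b) ≡ b
code-decode (false , false , false) = refl
code-decode (true  , false , true ) = refl
code-decode (false , true  , true ) = refl
code-decode (true  , true  , false) = refl
code-decode (false , true  , false) = refl
code-decode (false , false , true ) = refl
code-decode (true  , false , false) = refl
code-decode (true  , true  , true ) = refl

infix 4 _≟ˢ_
_≟ˢ_ : DecidableEquality Sym
g ≟ˢ g′ = map′ (λ eq → trans (sym (decode-code g)) (trans (cong decode eq) (decode-code g′)))
               (cong code) (code g ≟³ code g′)
  where _≟³_ = ×-≡-dec _≟ᵇ_ (×-≡-dec _≟ᵇ_ _≟ᵇ_)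

syms : List Sym
syms = r0 ∷ r90 ∷ r180 ∷ r270 ∷ h ∷ v ∷ d ∷ a ∷ []

∈-syms : ∀ g → g ∈ syms
∈-syms r0   = here refl
∈-syms r90  = there (here refl)
∈-syms r180 = there (there (here refl))
∈-syms r270 = there (there (there (here refl)))
∈-syms h    = there (there (there (there (here refl))))
∈-syms v    = there (there (there (there (there (here refl)))))
∈-syms d    = there (there (there (there (there (there (here refl))))))
∈-syms a    = there (there (there (there (there (there (there (here refl)))))))

Sym-all? : ∀ {P : Sym → Set} → Decidable P → Dec (∀ g → P g)
Sym-all? P? = map′ (λ Ps g → All.lookup Ps (∈-syms g)) (λ P∀ → All.tabulate λ {g} _ → P∀ g)
                   (all? P? syms)

-- A transposition on the left swaps the two reversal flags of the right factor.
_⊙_ : Bool × Bool × Bool → Bool × Bool × Bool → Bool × Bool × Bool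
(false , x , y) ⊙ (t , x′ , y′) = t     , x xor x′ , y xor y′
(true  , x , y) ⊙ (t , x′ , y′) = not t , x xor y′ , y xor x′

infixl 7 _∘ˢ_
_∘ˢ_ : Sym → Sym → Sym
g ∘ˢ g′ = decode (code g ⊙ code g′)

D₄-isGroup : IsGroup _≡_ _∘ˢ_ r0 inv
D₄-isGroup = record
  { isMonoid = record
    { isSemigroup = record
      { isMagma = isMagma _∘ˢ_
      ; assoc   = from-yes (Sym-all? λ f → Sym-all? λ g → Sym-all? λ g′ →
                              f ∘ˢ g ∘ˢ g′ ≟ˢ f ∘ˢ (g ∘ˢ g′))
      }
    ; identity = from-yes (Sym-all? λ g → r0 ∘ˢ g ≟ˢ g) , from-yes (Sym-all? λ g → g ∘ˢ r0 ≟ˢ g)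
    }
  ; inverse  = from-yes (Sym-all? λ g → inv g ∘ˢ g ≟ˢ r0)
             , from-yes (Sym-all? λ g → g ∘ˢ inv g ≟ˢ r0)
  ; ⁻¹-cong = cong inv
  }

D₄ : Group 0ℓ 0ℓ
D₄ = record { isGroup = D₄-isGroup }

open GroupTheory D₄-isGroup
open import Algebra.Properties.Group D₄ using (⁻¹-anti-homo-∙)

flip : ∀ {k} → Bool → Fin k → Fin k
flip false i = i
flip true  i = opposite i

flip-xor : ∀ {k} x y (i : Fin k) → flip x (flip y i) ≡ flip (x xor y) i
flip-xor false _     _ = refl
flip-xor true  false _ = refl
flip-xor true  true  i = opposite-involutive i

reflect : ∀ {m n} → Bool → Bool → Cell m n → Cell m n
reflect x y (i , j) = flip x i , flip y j

reflect-reflect : ∀ {m n} x y x′ y′ (c : Cell m n) →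
  reflect x y (reflect x′ y′ c) ≡ reflect (x xor x′) (y xor y′) c
reflect-reflect x y x′ y′ (i , j) = cong₂ _,_ (flip-xor x x′ i) (flip-xor y y′ j)

transposeIf : ∀ {m n} → Bool → Cell m n → Cell m n
transposeIf false c = c
transposeIf true  c = tr c

⟦_⟧ : ∀ {m n} → Bool × Bool × Bool → Cell m n → Cell m n
⟦ t , x , y ⟧ = reflect x y ∘ transposeIf t

act-⟦⟧ : ∀ {m n} g (c : Cell m n) → act g c ≡ ⟦ code g ⟧ c
act-⟦⟧ r0   c = refl
act-⟦⟧ r90  c = refl
act-⟦⟧ r180 c = refl
act-⟦⟧ r270 c = refl
act-⟦⟧ h    c = refl
act-⟦⟧ v    c = refl
act-⟦⟧ d    c = refl
act-⟦⟧ a    c = refl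

tr-square : ∀ {n} (c : Cell n n) → tr c ≡ swap c
tr-square {n} c with n ≟ℕ n
... | yes refl = refl
... | no n≢n   = ⊥-elim (n≢n refl)

tr-reflect : ∀ {n} x y (c : Cell n n) → tr (reflect x y c) ≡ reflect y x (tr c)
tr-reflect x y c = trans (tr-square (reflect x y c)) (cong (reflect y x) (sym (tr-square c)))

tr-transposeIf : ∀ {n} t (c : Cell n n) → tr (transposeIf t c) ≡ transposeIf (not t) c
tr-transposeIf false c = refl
tr-transposeIf true  c = trans (tr-square (tr c)) (cong swap (tr-square c))

-- On a non-square grid `tr` is the identity, so a transposing left factor breaks the law.
⟦⟧-⊙ : ∀ {m n} b b′ → m ≡ n ⊎ proj₁ b ≡ false → (c : Cell m n) →
  ⟦ b ⟧ (⟦ b′ ⟧ c) ≡ ⟦ b ⊙ b′ ⟧ c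
⟦⟧-⊙ (false , x , y) (t , x′ , y′) _           c = reflect-reflect x y x′ y′ (transposeIf t c)
⟦⟧-⊙ (true  , x , y) (t , x′ , y′) (inj₁ refl) c = begin
  reflect x y (tr (reflect x′ y′ (transposeIf t c)))     ≡⟨ cong (reflect x y) (tr-reflect x′ y′ _) ⟩
  reflect x y (reflect y′ x′ (tr (transposeIf t c)))     ≡⟨ reflect-reflect x y y′ x′ _ ⟩
  reflect (x xor y′) (y xor x′) (tr (transposeIf t c))   ≡⟨ cong (reflect (x xor y′) (y xor x′))
                                                                 (tr-transposeIf t c) ⟩
  reflect (x xor y′) (y xor x′) (transposeIf (not t) c)  ∎
⟦⟧-⊙ (true  , _ , _) _ (inj₂ ()) _

transposes : Sym → Bool
transposes = proj₁ ∘ code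

act-∘ˢ : ∀ {m n} g g′ → m ≡ n ⊎ transposes g ≡ false → (c : Cell m n) →
  act g (act g′ c) ≡ act (g ∘ˢ g′) c
act-∘ˢ g g′ square-or-untransposed c = begin
  act g (act g′ c)            ≡⟨ act-⟦⟧ g _ ⟩
  ⟦ code g ⟧ (act g′ c)       ≡⟨ cong ⟦ code g ⟧ (act-⟦⟧ g′ c) ⟩
  ⟦ code g ⟧ (⟦ code g′ ⟧ c)  ≡⟨ ⟦⟧-⊙ (code g) (code g′) square-or-untransposed c ⟩
  ⟦ code g ⊙ code g′ ⟧ c      ≡⟨ cong (λ b → ⟦ b ⟧ c) (code-decode (code g ⊙ code g′)) ⟨
  ⟦ code (g ∘ˢ g′) ⟧ c        ≡⟨ act-⟦⟧ (g ∘ˢ g′) c ⟨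
  act (g ∘ˢ g′) c             ∎

open import Data.List.Membership.DecPropositional _≟ˢ_ using (_∈?_)
open import Data.List.Relation.Unary.Unique.DecPropositional _≟ˢ_ using (unique?)

IsSubgroupList : List Sym → Set
IsSubgroupList G =
  Unique G × r0 ∈ G × All (λ g → All (λ g′ → g ∘ˢ g′ ∈ G) G) G × All (λ g → inv g ∈ G) G

isSubgroupList? : Decidable IsSubgroupList
isSubgroupList? G =
  unique? G ×-dec r0 ∈? G ×-dec all? (λ g → all? (λ g′ → g ∘ˢ g′ ∈? G) G) G
            ×-dec all? (λ g → inv g ∈? G) G

finiteSubgroup : ∀ {G} → IsSubgroupList G → FiniteSubgroup G
finiteSubgroup (G! , r0∈ , ∘ˢ∈ , inv∈) = record
  { unique = G!
  ; ε∈     = r0∈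
  ; ∙∈     = λ g∈ g′∈ → All.lookup (All.lookup ∘ˢ∈ g∈) g′∈
  ; ⁻¹∈    = All.lookup inv∈
  }

record GridSymmetries (m n : ℕ) (G : List Sym) : Set where
  field
    subgroup               : FiniteSubgroup G
    square-or-untransposed : ∀ {g} → g ∈ G → m ≡ n ⊎ transposes g ≡ false

data SymGroupShape (m n : ℕ) : List Sym → Set where
  square    : m ≡ n → SymGroupShape m n syms
  rectangle : SymGroupShape m n (r0 ∷ h ∷ v ∷ r180 ∷ [])
  line      : SymGroupShape m n (r0 ∷ r180 ∷ [])

symGroup-shape : ∀ m n → SymGroupShape m n (symGroup m n)
symGroup-shape m n with m ≟ℕ n | 2 ≤?ℕ m | 2 ≤?ℕ n
... | yes m≡n | yes _ | _     = square m≡n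
... | yes _   | no _  | _     = line
... | no _    | yes _ | yes _ = rectangle
... | no _    | yes _ | no _  = line
... | no _    | no _  | _     = line

gridSymmetries : ∀ {m n G} → SymGroupShape m n G → GridSymmetries m n G
gridSymmetries (square m≡n) = record
  { subgroup               = finiteSubgroup (from-yes (isSubgroupList? syms))
  ; square-or-untransposed = λ _ → inj₁ m≡n
  }
gridSymmetries rectangle = record
  { subgroup               = finiteSubgroup (from-yes (isSubgroupList? (r0 ∷ h ∷ v ∷ r180 ∷ [])))
  ; square-or-untransposed =
      inj₂ ∘ All.lookup {P = λ g → transposes g ≡ false} (refl ∷ refl ∷ refl ∷ refl ∷ [])
  }
gridSymmetries line = record
  { subgroup               = finiteSubgroup (from-yes (isSubgroupList? (r0 ∷ r180 ∷ [])))
  ; square-or-untransposed =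
      inj₂ ∘ All.lookup {P = λ g → transposes g ≡ false} (refl ∷ refl ∷ [])
  }

concatMap-map : ∀ (f : A → B → C) xs ys →
  concatMap (λ x → map (f x) ys) xs ≡ cartesianProductWith f xs ys
concatMap-map f []       ys = refl
concatMap-map f (x ∷ xs) ys = cong (map (f x) ys ++_) (concatMap-map f xs ys)

allVec-unique : ∀ {xs : List A} → Unique xs → ∀ k → Unique (allVec xs k)
allVec-unique xs! zero    = [] ∷ []
allVec-unique {xs = xs} xs! (suc k) = subst Unique (sym (concatMap-map _∷_ xs (allVec xs k)))
  (Unique.cartesianProductWith⁺ _∷_ ∷-injective xs! (allVec-unique xs! k))

allVec-complete : ∀ {xs : List A} → (∀ x → x ∈ xs) → ∀ {k} (w : Vec A k) → w ∈ allVec xs k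
allVec-complete xs-complete []      = here refl
allVec-complete {xs = xs} xs-complete {suc k} (x ∷ w) =
  subst ((x ∷ w) ∈_) (sym (concatMap-map _∷_ xs (allVec xs k)))
        (∈-cartesianProductWith⁺ _∷_ (xs-complete x) (allVec-complete xs-complete w))

allBoards-unique : ∀ m n → Unique (allBoards m n)
allBoards-unique m n = allVec-unique (allVec-unique (((λ ()) ∷ []) ∷ [] ∷ []) n) m

allBoards-complete : ∀ m n (B : Board m n) → B ∈ allBoards m n
allBoards-complete m n = allVec-complete (allVec-complete λ { true → here refl ; false → there (here refl) })

cells-unique : ∀ m n → Unique (cells m n)
cells-unique m n = Unique.cartesianProduct⁺ (Unique.allFin⁺ m) (Unique.allFin⁺ n)

cells-complete : ∀ m n (c : Cell m n) → c ∈ cells m n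
cells-complete m n (i , j) = ∈-cartesianProduct⁺ (∈-allFin i) (∈-allFin j)

-- `stabilises` folds a function local to its where-block over `allBoards m n`;
-- with-abstracting that list solves the meta-variable below to the local function.
mutual
  stabilisesOn : ∀ {m n} r k (ρ : Cell m n → Fin k) (p : Vec ℕ k) (g : Sym) → List (Board m n) → Bool
  stabilisesOn {m} {n} r k ρ p g boards = _

  stabilises-unfold : ∀ {m n} r k (ρ : Cell m n → Fin k) (p : Vec ℕ k) g →
    stabilises m n r k ρ p g ≡ stabilisesOn r k ρ p g (allBoards m n)
  stabilises-unfold {m} {n} r k ρ p g with allBoards m n
  ... | boards = refl

module GridBoards (m n : ℕ) where

  open GridSymmetries (gridSymmetries (symGroup-shape m n)) public
  open FiniteSubgroup subgroup public

  act-∘ˢ-grid : ∀ {g g′} → g ∈ symGroup m n → g′ ∈ symGroup m n →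
    ∀ c → act g (act g′ c) ≡ act (g ∘ˢ g′) c
  act-∘ˢ-grid {g} {g′} g∈ _ = act-∘ˢ g g′ (square-or-untransposed g∈)

  module CellAction = Action subgroup act (λ _ → refl) act-∘ˢ-grid (cells-unique m n) (cells-complete m n)

  at-⋆ : ∀ g (B : Board m n) c → at (g ⋆ B) c ≡ at B (act (inv g) c)
  at-⋆ g B (i , j) = trans (cong (λ row → lookup row j) (lookup∘tabulate _ i)) (lookup∘tabulate _ j)

  ⋆-identity : ∀ (B : Board m n) → r0 ⋆ B ≡ B
  ⋆-identity B = trans (tabulate-cong λ i → tabulate∘lookup (lookup B i)) (tabulate∘lookup B)

  ⋆-∘ˢ : ∀ {g g′} → g ∈ symGroup m n → g′ ∈ symGroup m n → ∀ B → g ⋆ (g′ ⋆ B) ≡ (g ∘ˢ g′) ⋆ B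
  ⋆-∘ˢ {g} {g′} g∈ g′∈ B = tabulate-cong λ i → tabulate-cong λ j → begin
    at (g′ ⋆ B) (act (inv g) (i , j))
      ≡⟨ at-⋆ g′ B _ ⟩
    at B (act (inv g′) (act (inv g) (i , j)))
      ≡⟨ cong (at B) (act-∘ˢ-grid (⁻¹∈ g′∈) (⁻¹∈ g∈) (i , j)) ⟩
    at B (act (inv g′ ∘ˢ inv g) (i , j))
      ≡⟨ cong (λ g″ → at B (act g″ (i , j))) (⁻¹-anti-homo-∙ g g′) ⟨
    at B (act (inv (g ∘ˢ g′)) (i , j)) ∎

  open Action subgroup _⋆_ ⋆-identity ⋆-∘ˢ (allBoards-unique m n) (allBoards-complete m n) public

  translates-equivalent : ∀ {g g′} {C B : Board m n} → g ∈ symGroup m n → g′ ∈ symGroup m n →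
    g ⋆ C ≡ B → Equivalent B (g′ ⋆ C)
  translates-equivalent {g} {g′} {C} g∈ g′∈ gC≡B =
    g′ ∘ˢ inv g , ∙∈ g′∈ (⁻¹∈ g∈) ,
    trans (cong ((g′ ∘ˢ inv g) ⋆_) (sym gC≡B)) (⋆-// g′∈ g∈ C)

  blocked-⋆ : ∀ {g} → g ∈ symGroup m n → ∀ B → blocked (g ⋆ B) ≡ blocked B
  blocked-⋆ {g} g∈ B =
    trans (count-cong {xs = cells m n} λ {c} _ → at-⋆ g B c) (CellAction.count-⋆ (at B) (⁻¹∈ g∈))

  module _ {k} (ρ : Cell m n → Fin k) (ρ-compatible : RegionsCompatible m n k ρ) where

    partition-⋆ : ∀ {g} (g∈ : g ∈ symGroup m n) B x →
      lookup (partition ρ (g ⋆ B)) x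
        ≡ lookup (partition ρ B) (proj₁ (ρ-compatible (inv g) (⁻¹∈ g∈) x))
    partition-⋆ {g} g∈ B x = begin
      lookup (partition ρ (g ⋆ B)) x
        ≡⟨ lookup∘tabulate _ x ⟩
      count (λ c → at (g ⋆ B) c ∧ does (ρ c ≟ᶠ x)) (cells m n)
        ≡⟨ count-cong {xs = cells m n} (λ {c} _ → cong₂ _∧_ (at-⋆ g B c) (same-region c)) ⟩
      count (λ c → at B (act (inv g) c) ∧ does (ρ (act (inv g) c) ≟ᶠ y)) (cells m n)
        ≡⟨ CellAction.count-⋆ (λ c → at B c ∧ does (ρ c ≟ᶠ y)) (⁻¹∈ g∈) ⟩
      count (λ c → at B c ∧ does (ρ c ≟ᶠ y)) (cells m n)
        ≡⟨ lookup∘tabulate _ y ⟨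
      lookup (partition ρ B) y ∎
      where
      y = proj₁ (ρ-compatible (inv g) (⁻¹∈ g∈) x)
      same-region : ∀ c → does (ρ c ≟ᶠ x) ≡ does (ρ (act (inv g) c) ≟ᶠ y)
      same-region c = let to , from = proj₂ (ρ-compatible (inv g) (⁻¹∈ g∈) x) c in
        does-⇔ (mk⇔ to from) (ρ c ≟ᶠ x) (ρ (act (inv g) c) ≟ᶠ y)

    partition-⋆-cong : ∀ {g} → g ∈ symGroup m n → ∀ {B B′} →
      partition ρ B ≡ partition ρ B′ → partition ρ (g ⋆ B) ≡ partition ρ (g ⋆ B′)
    partition-⋆-cong {g} g∈ {B} {B′} eq = begin
      partition ρ (g ⋆ B)                       ≡⟨ tabulate∘lookup _ ⟨
      tabulate (lookup (partition ρ (g ⋆ B)))   ≡⟨ tabulate-cong (λ x → begin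
          lookup (partition ρ (g ⋆ B)) x          ≡⟨ partition-⋆ g∈ B x ⟩
          lookup (partition ρ B) _                ≡⟨ cong (λ P → lookup P _) eq ⟩
          lookup (partition ρ B′) _               ≡⟨ partition-⋆ g∈ B′ x ⟨
          lookup (partition ρ (g ⋆ B′)) x         ∎) ⟩
      tabulate (lookup (partition ρ (g ⋆ B′)))  ≡⟨ tabulate∘lookup _ ⟩
      partition ρ (g ⋆ B′)                      ∎

    inClass-sound : ∀ r p B → T (inClass ρ r p B) → blocked B ≡ r × partition ρ B ≡ p
    inClass-sound r p B B∈ = let b , q = Equivalence.to T-∧ B∈ in
      ≡ᵇ⇒≡ (blocked B) r b , does-sound (≡-dec _≟ℕ_ (partition ρ B) p) q

    inClass-complete : ∀ r p B → blocked B ≡ r → partition ρ B ≡ p → T (inClass ρ r p B)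
    inClass-complete r p B b q =
      Equivalence.from T-∧ (≡⇒≡ᵇ (blocked B) r b , does-complete (≡-dec _≟ℕ_ (partition ρ B) p) q)

    inClass-isBlock : ∀ r p → IsBlock (inClass ρ r p)
    inClass-isBlock r p g B B′ g∈ B∈ B′∈ = cong₂ (λ b q → (b ≡ᵇ r) ∧ does (≡-dec _≟ℕ_ q p))
      same-blocked (partition-⋆-cong g∈ {B} {B′} same-partition)
      where
      same-blocked : blocked (g ⋆ B) ≡ blocked (g ⋆ B′)
      same-blocked = begin
        blocked (g ⋆ B)   ≡⟨ blocked-⋆ g∈ B ⟩
        blocked B         ≡⟨ proj₁ (inClass-sound r p B B∈) ⟩
        r                 ≡⟨ proj₁ (inClass-sound r p B′ B′∈) ⟨
        blocked B′        ≡⟨ blocked-⋆ g∈ B′ ⟨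
        blocked (g ⋆ B′)  ∎
      same-partition : partition ρ B ≡ partition ρ B′
      same-partition = trans (proj₂ (inClass-sound r p B B∈)) (sym (proj₂ (inClass-sound r p B′ B′∈)))

    stabilises≡stabiliser : ∀ r p g → stabilises m n r k ρ p g ≡ stabiliser (inClass ρ r p) g
    stabilises≡stabiliser r p g = begin
      stabilises m n r k ρ p g
        ≡⟨ stabilises-unfold r k ρ p g ⟩
      stabilisesOn r k ρ p g (allBoards m n)
        ≡⟨ foldr-universal (stabilisesOn r k ρ p g) step true refl (λ _ _ → refl) (allBoards m n) ⟩
      foldr step true (allBoards m n)
        ≡⟨ foldr-universal (all test) step true refl (λ _ _ → refl) (allBoards m n) ⟨
      stabiliser (inClass ρ r p) g ∎
      where
      test : Board m n → Bool
      test B = does (inClass ρ r p B ≟ᵇ inClass ρ r p (g ⋆ B))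
      step : Board m n → Bool → Bool
      step B b = test B ∧ b

module Classes (m n r : ℕ) {k} (ρ : Cell m n → Fin k) (ρ-compatible : RegionsCompatible m n k ρ)
               {t} (p : Fin t → Vec ℕ k) where

  open GridBoards m n

  π : Fin t → Board m n → Bool
  π i = inClass ρ r (p i)

  stabIndex-as-count : ∀ i →
    stabIndex m n r k ρ (p i) ≡ length (symGroup m n) div count (stabiliser (π i)) (symGroup m n)
  stabIndex-as-count i = cong (length (symGroup m n) div_) (begin
    length (filter (λ g → stabilises m n r k ρ (p i) g ≟ᵇ true) (symGroup m n))
      ≡⟨ count-filter _ (symGroup m n) ⟨
    count (stabilises m n r k ρ (p i)) (symGroup m n)
      ≡⟨ count-cong {xs = symGroup m n} (λ {g} _ → stabilises≡stabiliser ρ ρ-compatible r (p i) g) ⟩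
    count (stabiliser (π i)) (symGroup m n) ∎)

  count-saturation-class : ∀ i →
    count (saturation (π i)) (allBoards m n) ≡ classSize m n r k ρ (p i) * stabIndex m n r k ρ (p i)
  count-saturation-class i = trans (count-saturation {π = π i} (inClass-isBlock ρ ρ-compatible r (p i)))
                                   (cong (classSize m n r k ρ (p i) *_) (sym (stabIndex-as-count i)))

  module _
    (partitions-distinct : ∀ (i j : Fin t) (B : Board m n) → blocked B ≡ r →
        partition ρ B ≡ p i → partition ρ B ≡ p j → i ≡ j)
    (representatives-cover : ∀ (B : Board m n) → blocked B ≡ r →
        ∃ λ (B′ : Board m n) → (blocked B′ ≡ r × ∃ λ i → partition ρ B′ ≡ p i) × Equivalent B B′)
    (representatives-separated : ∀ (B B′ : Board m n) →
        (blocked B ≡ r × ∃ λ i → partition ρ B ≡ p i) →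
        (blocked B′ ≡ r × ∃ λ i → partition ρ B′ ≡ p i) →
        Equivalent B B′ → partition ρ B ≡ partition ρ B′) where

    saturations-partition : ∀ C →
      count (λ i → saturation (π i) C) (allFin t) ≡ (if blocked C ≡ᵇ r then 1 else 0)
    saturations-partition C with blocked C ≡ᵇ r in C-blocked
    ... | false = count-zero {xs = allFin t} λ {i} _ C∈ →
      let g , g∈ , gC∈ = find (any⁻ (λ g → π i (g ⋆ C)) (symGroup m n) C∈)
          gC-blocked , _ = inClass-sound ρ ρ-compatible r (p i) (g ⋆ C) gC∈
      in subst T C-blocked (≡⇒≡ᵇ (blocked C) r (trans (sym (blocked-⋆ g∈ C)) gC-blocked))
    ... | true with representatives-cover C (≡ᵇ⇒≡ (blocked C) r (subst T (sym C-blocked) _))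
    ...   | B′ , B′-class@(B′-blocked , i₀ , B′-partition) , g , g∈ , gC≡B′ =
      trans (count-cong {xs = allFin t} λ {i} _ → bool-ext (to i) (from i))
            (count-≟ _≟ᶠ_ (Unique.allFin⁺ t) (∈-allFin i₀))
      where
      to : ∀ i → T (saturation (π i) C) → T (does (i ≟ᶠ i₀))
      to i C∈ with find (any⁻ (λ g → π i (g ⋆ C)) (symGroup m n) C∈)
      ... | g′ , g′∈ , g′C∈ =
        let g′C-blocked , g′C-partition = inClass-sound ρ ρ-compatible r (p i) (g′ ⋆ C) g′C∈
            same-partition = representatives-separated B′ (g′ ⋆ C) B′-class
                               (g′C-blocked , i , g′C-partition)
                               (translates-equivalent {C = C} g∈ g′∈ gC≡B′)
        in does-complete (i ≟ᶠ i₀) (sym (partitions-distinct i₀ i B′ B′-blocked B′-partition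
                                          (trans same-partition g′C-partition)))

      from : ∀ i → T (does (i ≟ᶠ i₀)) → T (saturation (π i) C)
      from i i≡i₀ with does-sound (i ≟ᶠ i₀) i≡i₀
      ... | refl = any⁺ (λ g → π i₀ (g ⋆ C)) (lose g∈ (subst (T ∘ π i₀) (sym gC≡B′)
                     (inClass-complete ρ ρ-compatible r (p i₀) B′ B′-blocked B′-partition)))

theorem3p1 : (m n r : ℕ) → 1 ≤ m → 1 ≤ n → 1 ≤ r → r ≤ m * n →
  (k : ℕ) (ρ : Cell m n → Fin k) → RegionsCompatible m n k ρ →
  (t : ℕ) (p : Fin t → Vec ℕ k) →
  (∀ (i j : Fin t) (B : Board m n) → blocked B ≡ r →
      partition ρ B ≡ p i → partition ρ B ≡ p j → i ≡ j) →
  (∀ (B : Board m n) → blocked B ≡ r →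
      ∃ λ (B' : Board m n) → (blocked B' ≡ r × ∃ λ i → partition ρ B' ≡ p i) × Equivalent B B') →
  (∀ (B B' : Board m n) →
      (blocked B ≡ r × ∃ λ i → partition ρ B ≡ p i) →
      (blocked B' ≡ r × ∃ λ i → partition ρ B' ≡ p i) →
      Equivalent B B' → partition ρ B ≡ partition ρ B') →
  numBoards m n r ≡ sum (map (λ i → classSize m n r k ρ (p i) * stabIndex m n r k ρ (p i)) (allFin t))
theorem3p1 m n r _ _ _ _ k ρ ρ-compatible t p distinct cover separated = begin
  numBoards m n r
    ≡⟨ count-partition _ (saturation ∘ π) (allBoards m n) (allFin t)
                       (saturations-partition distinct cover separated) ⟩
  sum (map (λ i → count (saturation (π i)) (allBoards m n)) (allFin t))
    ≡⟨ cong sum (map-cong count-saturation-class (allFin t)) ⟩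
  sum (map (λ i → classSize m n r k ρ (p i) * stabIndex m n r k ρ (p i)) (allFin t)) ∎
  where
  open Classes m n r ρ ρ-compatible p
  open GridBoards m n using (saturation)
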